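{- Every stateless deterministic CentLocal-algorithm $C$ (whose queries are vertices) whose probe radius is at most $r$ can be simulated by a deterministic $\mathrm{DistLocal}[r]$-algorithm $D$; that is, for every vertex $v$, the local output of $D$ at $v$ equals the answer that $C$ computes for the query $v$.
   Context: Graphs are undirected and labeled (distinct IDs, ports at each vertex pointing to its neighbors in a fixed arbitrary way), with $n$ vertices and maximum degree $\Delta$. A CentLocal-algorithm knows $n,\Delta$, accesses the graph only via probes $(v,i)$ returning the $i$-th neighbor of $v$ (and the port number of $v$ there) or null, and answers an online sequence of queries consistently with one fixed solution. Stateless means it stores nothing between queries. Its probe radius is at most $r$ if for every query $q$ all probes are to vertices within distance $r$ of $q$. In the DistLocal model each vertex is a processor knowing its ID, degree, $\Delta$, $n$ and ports; in synchronous rounds vertices exchange unbounded-length messages with neighbors and compute arbitrarily; $\mathrm{DistLocal}[r]$ means $r$ rounds, after which each vertex produces a local output. -}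

module Defs where

open import Data.Nat using (ℕ; zero; suc; _≤_; _<?_)
open import Data.Fin using (Fin; toℕ; fromℕ<)
open import Data.Fin.Properties using (any?)
open import Data.Nat.Properties using (_≟_)
open import Data.Maybe using (Maybe; just; nothing)
open import Data.Product using (Σ; ∃; _×_; _,_)
open import Data.Unit using (⊤)
open import Relation.Nullary using (¬_; yes; no)
open import Relation.Binary.PropositionalEquality using (_≡_)

record Graph (n Δ : ℕ) : Set where
  field
    ident     : Fin n → ℕ
    ident-inj : ∀ u v → ident u ≡ ident v → u ≡ v
    deg       : Fin n → ℕ
    deg≤Δ     : ∀ v → deg v ≤ Δ
    nbr       : (v : Fin n) → Fin (deg v) → Fin n
    -- the port number, at the neighbour, of the edge back to v
    back      : (v : Fin n) (i : Fin (deg v)) → Fin (deg (nbr v i))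
    nbr-back  : ∀ v i → nbr (nbr v i) (back v i) ≡ v
    loopless  : ∀ v i → ¬ (nbr v i ≡ v)
    nbr-inj   : ∀ v i j → nbr v i ≡ nbr v j → i ≡ j

open Graph public

data Within {n Δ : ℕ} (G : Graph n Δ) : ℕ → Fin n → Fin n → Set where
  here : ∀ {k q} → Within G k q q
  step : ∀ {k q u} (i : Fin (deg G u)) → Within G k q u → Within G (suc k) q (nbr G u i)

vertexWithId : ∀ {n Δ} → Graph n Δ → ℕ → Maybe (Fin n)
vertexWithId G p with any? (λ w → ident G w ≟ p)
... | yes (w , _) = just w
... | no _ = nothing

-- Answer to the probe (p , i): the i-th neighbour of the vertex with ID p,
-- given as (ID of the neighbour , port number at the neighbour), or null.
probeAnswer : ∀ {n Δ} → Graph n Δ → ℕ → ℕ → Maybe (ℕ × ℕ)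
probeAnswer G p i with vertexWithId G p
... | nothing = nothing
... | just w with i <? deg G w
...   | yes i<d = just (ident G (nbr G w (fromℕ< i<d)) , toℕ (back G w (fromℕ< i<d)))
...   | no _ = nothing

-- A deterministic CentLocal computation answering one query: an
-- adaptive probing strategy (a finite decision tree).  A stateless
-- deterministic CentLocal-algorithm is a function from the query's ID
-- to such a strategy (nothing is stored between queries).

data CTree (Out : Set) : Set where
  ret   : Out → CTree Out
  probe : (p i : ℕ) → (Maybe (ℕ × ℕ) → CTree Out) → CTree Out

runC : ∀ {n Δ} {Out : Set} → Graph n Δ → CTree Out → Out
runC G (ret o) = o
runC G (probe p i k) = runC G (k (probeAnswer G p i))

ProbesWithin : ∀ {n Δ} {Out : Set} → Graph n Δ → ℕ → Fin n → CTree Out → Set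
ProbesWithin G r q (ret o) = ⊤
ProbesWithin G r q (probe p i k) =
  (∃ λ w → ident G w ≡ p × Within G r q w) × ProbesWithin G r q (k (probeAnswer G p i))

-- Deterministic DistLocal algorithms (n and Δ are fixed from outside, so
-- they are known to the algorithm).  Initially a vertex knows its ID,
-- its degree, and its ports: for each port the neighbour's ID and the
-- port number at the neighbour.

record DistAlg (Out : Set) : Set₁ where
  field
    State  : Set
    Msg    : Set
    init   : (id d : ℕ) → (Fin d → ℕ × ℕ) → State
    send   : (d : ℕ) → State → Fin d → Msg
    recv   : (d : ℕ) → State → (Fin d → Msg) → State
    output : State → Out

module _ {n Δ : ℕ} {Out : Set} (G : Graph n Δ) (D : DistAlg Out) where
  open DistAlg D

  stateAt : ℕ → Fin n → State
  stateAt zero v = init (ident G v) (deg G v) (λ i → ident G (nbr G v i) , toℕ (back G v i))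
  stateAt (suc t) v =
    recv (deg G v) (stateAt t v)
         (λ i → send (deg G (nbr G v i)) (stateAt t (nbr G v i)) (back G v i))

  distOutput : ℕ → Fin n → Out
  distOutput r v = output (stateAt r v)

-- Every vertex floods its own port list through the network, so after t rounds
-- it holds the correct port lists of all vertices within distance t.  A CentLocal
-- computation with probe radius r started at v only probes vertices within
-- distance r of v, so after r rounds v can answer all of its probes from this
-- table and run the computation locally.
module Submission where

open import Defs
open import Data.Nat using (ℕ; zero; suc; _+_; _<?_)
open import Data.Nat.Properties using (_≟_; +-suc; +-identityʳ)
open import Data.Fin using (Fin; toℕ; fromℕ<)
open import Data.Fin.Properties using (any?)
open import Data.Maybe using (Maybe; just; nothing; _<∣>_; _>>=_; Is-just)
open import Data.Maybe.Relation.Unary.All as All using (All; just; nothing)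
open import Data.Maybe.Relation.Unary.All.Properties using (<∣>⁺)
open import Data.Maybe.Relation.Unary.Any using (just)
open import Data.Product using (Σ; _×_; _,_; proj₁; proj₂)
open import Data.Vec.Functional using (foldr)
open import Function using (_∘_; _$_)
open import Relation.Nullary using (yes; no; contradiction)
open import Relation.Binary.PropositionalEquality
  using (_≡_; _≗_; refl; sym; cong; subst; module ≡-Reasoning)

module _ {A : Set} where

  <∣>-is-justˡ : ∀ {mx my : Maybe A} → Is-just mx → Is-just (mx <∣> my)
  <∣>-is-justˡ (just _) = just _

  <∣>-is-justʳ : ∀ (mx : Maybe A) {my} → Is-just my → Is-just (mx <∣> my)
  <∣>-is-justʳ (just _) _  = just _
  <∣>-is-justʳ nothing  jy = jy

  firstJust : ∀ {d} → (Fin d → Maybe A) → Maybe A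
  firstJust = foldr _<∣>_ nothing

  firstJust-all : ∀ {P : A → Set} {d} (ms : Fin d → Maybe A) →
                  (∀ i → All P (ms i)) → All P (firstJust ms)
  firstJust-all {d = zero}  ms all = nothing
  firstJust-all {d = suc d} ms all = <∣>⁺ (all Fin.zero) (firstJust-all (ms ∘ Fin.suc) (all ∘ Fin.suc))

  firstJust-is-just : ∀ {d} (ms : Fin d → Maybe A) i → Is-just (ms i) → Is-just (firstJust ms)
  firstJust-is-just ms Fin.zero    j = <∣>-is-justˡ j
  firstJust-is-just ms (Fin.suc i) j = <∣>-is-justʳ (ms Fin.zero) (firstJust-is-just (ms ∘ Fin.suc) i j)

  >>=-is-just : ∀ {B : Set} {m : Maybe A} {f : A → Maybe B} {y} →
                Is-just m → All (λ x → f x ≡ y) m → (m >>= f) ≡ y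
  >>=-is-just (just _) (just eq) = eq

ProbeOracle : Set
ProbeOracle = ℕ → ℕ → Maybe (ℕ × ℕ)

runWith : {Out : Set} → ProbeOracle → CTree Out → Out
runWith O (ret o)       = o
runWith O (probe p i k) = runWith O (k (O p i))

-- The answers to the probes (id v , i), i ∈ ℕ, for a vertex v with the given ports.
View : Set
View = ℕ → Maybe (ℕ × ℕ)

-- Views indexed by vertex ID; nothing for IDs not (yet) known.
Table : Set
Table = ℕ → Maybe View

portView : (d : ℕ) → (Fin d → ℕ × ℕ) → View
portView d ports i with i <? d
... | yes i<d = just (ports (fromℕ< i<d))
... | no _    = nothing

ownTable : (id d : ℕ) → (Fin d → ℕ × ℕ) → Table
ownTable id d ports p with id ≟ p
... | yes _ = just (portView d ports)
... | no _  = nothing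

gather : ∀ {d} → Table → (Fin d → Table) → Table
gather T Ts p = T p <∣> firstJust (λ i → Ts i p)

consult : Table → ProbeOracle
consult T p i = T p >>= λ view → view i

simulation : {Out : Set} → (ℕ → CTree Out) → DistAlg Out
simulation C = record
  { State  = ℕ × Table
  ; Msg    = Table
  ; init   = λ id d ports → id , ownTable id d ports
  ; send   = λ _ s _ → proj₂ s
  ; recv   = λ _ s Ts → proj₁ s , gather (proj₂ s) Ts
  ; output = λ s → runWith (consult (proj₂ s)) (C (proj₁ s))
  }

module _ {n Δ : ℕ} (G : Graph n Δ) where

  portLabels : (v : Fin n) → Fin (deg G v) → ℕ × ℕ
  portLabels v i = ident G (nbr G v i) , toℕ (back G v i)

  vertexWithId-ident : ∀ w → vertexWithId G (ident G w) ≡ just w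
  vertexWithId-ident w with any? (λ u → ident G u ≟ ident G w)
  ... | yes (u , eq) = cong just (ident-inj G u w eq)
  ... | no ∄u        = contradiction (w , refl) ∄u

  probeAnswer-ident : ∀ w → probeAnswer G (ident G w) ≗ portView (deg G w) (portLabels w)
  probeAnswer-ident w i with vertexWithId G (ident G w) | vertexWithId-ident w
  ... | just .w | refl with i <? deg G w
  ...   | yes _ = refl
  ...   | no _  = refl

  runWith-ball : ∀ {Out r q} (O : ProbeOracle) →
                 (∀ {w} → Within G r q w → O (ident G w) ≗ probeAnswer G (ident G w)) →
                 (T : CTree Out) → ProbesWithin G r q T → runWith O T ≡ runC G T
  runWith-ball O agree (ret o)       _                          = refl
  runWith-ball O agree (probe p i k) ((w , refl , w∈) , probes)
    rewrite agree w∈ i = runWith-ball O agree (k _) probes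

  module _ {Out : Set} (C : ℕ → CTree Out) where

    table : ℕ → Fin n → Table
    table t v = proj₂ (stateAt G (simulation C) t v)

    ident-stateAt : ∀ t v → proj₁ (stateAt G (simulation C) t v) ≡ ident G v
    ident-stateAt zero    v = refl
    ident-stateAt (suc t) v = ident-stateAt t v

    table-sound : ∀ t v p → All (_≗ probeAnswer G p) (table t v p)
    table-sound zero v p with ident G v ≟ p
    ... | yes refl = just (sym ∘ probeAnswer-ident v)
    ... | no _     = nothing
    table-sound (suc t) v p =
      <∣>⁺ (table-sound t v p) (firstJust-all _ (λ i → table-sound t (nbr G v i) p))

    Knows : ℕ → Fin n → ℕ → Set
    Knows t v p = Is-just (table t v p)

    knows-self : ∀ v → Knows 0 v (ident G v)
    knows-self v with ident G v ≟ ident G v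
    ... | yes _ = just _
    ... | no ≢  = contradiction refl ≢

    knows-+ : ∀ k {t v p} → Knows t v p → Knows (k + t) v p
    knows-+ zero    known = known
    knows-+ (suc k) known = <∣>-is-justˡ (knows-+ k known)

    knows-nbr : ∀ {t u p} i → Knows t (nbr G u i) p → Knows (suc t) u p
    knows-nbr {t} {u} {p} i known =
      <∣>-is-justʳ (table t u p) (firstJust-is-just (λ j → table t (nbr G u j) p) i known)

    knows-within : ∀ {k q w t p} → Within G k q w → Knows t w p → Knows (k + t) q p
    knows-within {k} here known = knows-+ k known
    knows-within {suc k} {q} {t = t} {p} (step i u∈) known =
      subst (λ s → Knows s q p) (+-suc k t) (knows-within u∈ (knows-nbr {t} i known))

    consult-ball : ∀ {r v w} → Within G r v w →
                   consult (table r v) (ident G w) ≗ probeAnswer G (ident G w)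
    consult-ball {r} {v} {w} w∈ i = >>=-is-just knows (All.map (_$ i) (table-sound r v (ident G w)))
      where
      knows : Knows r v (ident G w)
      knows = subst (λ s → Knows s v (ident G w)) (+-identityʳ r) (knows-within w∈ (knows-self w))

proposition3 : {Out : Set} (n Δ r : ℕ) (C : ℕ → CTree Out)
    → ((G : Graph n Δ) (q : Fin n) → ProbesWithin G r q (C (ident G q)))
    → Σ (DistAlg Out) (λ D → (G : Graph n Δ) (v : Fin n) → distOutput G D r v ≡ runC G (C (ident G v)))
proposition3 n Δ r C probesLocal = simulation C , λ G v →
  let open ≡-Reasoning in
  begin
    distOutput G (simulation C) r v
  ≡⟨ cong (runWith (consult (table G C r v)) ∘ C) (ident-stateAt G C r v) ⟩
    runWith (consult (table G C r v)) (C (ident G v))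
  ≡⟨ runWith-ball G _ (consult-ball G C) (C (ident G v)) (probesLocal G v) ⟩
    runC G (C (ident G v))
  ∎
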